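{- Let $M$ be a $3\times 3$ semi-magic square and let $\mathbf{a}=(a_1,\dots,a_6)$ be any sextuple of non-negative integers with $M=\sum_{t=1}^6 a_tP_t$. Then the minimum and maximum entries of $M$ are $$\min(M)=\min(a_1,a_2,a_3)+\min(a_4,a_5,a_6),\qquad \max(M)=\max(a_1,a_2,a_3)+\max(a_4,a_5,a_6).$$ In particular these two expressions do not depend on which representing sextuple $\mathbf{a}$ of $M$ is used.
   Context: A semi-magic square of size 3 is a $3\times 3$ matrix with non-negative integer entries whose row sums and column sums all equal a common value $\rho(M)$ (the line sum). The permutation matrices are fixed as: $P_1=I$, $P_2=\begin{bmatrix}0&0&1\\1&0&0\\0&1&0\end{bmatrix}$, $P_3=\begin{bmatrix}0&1&0\\0&0&1\\1&0&0\end{bmatrix}$, $P_4=\begin{bmatrix}0&0&1\\0&1&0\\1&0&0\end{bmatrix}$, $P_5=\begin{bmatrix}0&1&0\\1&0&0\\0&0&1\end{bmatrix}$, $P_6=\begin{bmatrix}1&0&0\\0&0&1\\0&1&0\end{bmatrix}$. A sextuple $\mathbf a$ of non-negative integers represents $M$ if $M=\sum_t a_tP_t$. $\min(M)$ and $\max(M)$ denote the smallest and largest entries of $M$. -}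

module Defs where

open import Data.Nat using (ℕ; zero; suc; _+_; _*_; _⊓_; _⊔_)
open import Data.Fin using (Fin; zero; suc)
open import Data.Product using (∃; _×_)
open import Relation.Binary.PropositionalEquality using (_≡_)

Matrix3 : Set
Matrix3 = Fin 3 → Fin 3 → ℕ

f0 f1 f2 : Fin 3
f0 = zero
f1 = suc zero
f2 = suc (suc zero)

rowSum : Matrix3 → Fin 3 → ℕ
rowSum M i = M i f0 + M i f1 + M i f2

colSum : Matrix3 → Fin 3 → ℕ
colSum M j = M f0 j + M f1 j + M f2 j

SemiMagic : Matrix3 → Set
SemiMagic M = ∃ λ ρ → (∀ i → rowSum M i ≡ ρ) × (∀ j → colSum M j ≡ ρ)

mat : ℕ → ℕ → ℕ → ℕ → ℕ → ℕ → ℕ → ℕ → ℕ → Matrix3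
mat a b c d e f g h k zero zero = a
mat a b c d e f g h k zero (suc zero) = b
mat a b c d e f g h k zero (suc (suc zero)) = c
mat a b c d e f g h k (suc zero) zero = d
mat a b c d e f g h k (suc zero) (suc zero) = e
mat a b c d e f g h k (suc zero) (suc (suc zero)) = f
mat a b c d e f g h k (suc (suc zero)) zero = g
mat a b c d e f g h k (suc (suc zero)) (suc zero) = h
mat a b c d e f g h k (suc (suc zero)) (suc (suc zero)) = k

P₁ P₂ P₃ P₄ P₅ P₆ : Matrix3
P₁ = mat 1 0 0  0 1 0  0 0 1
P₂ = mat 0 0 1  1 0 0  0 1 0
P₃ = mat 0 1 0  0 0 1  1 0 0
P₄ = mat 0 0 1  0 1 0  1 0 0
P₅ = mat 0 1 0  1 0 0  0 0 1
P₆ = mat 1 0 0  0 0 1  0 1 0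

Represents : ℕ → ℕ → ℕ → ℕ → ℕ → ℕ → Matrix3 → Set
Represents a₁ a₂ a₃ a₄ a₅ a₆ M =
  ∀ i j → M i j ≡ a₁ * P₁ i j + a₂ * P₂ i j + a₃ * P₃ i j
                + a₄ * P₄ i j + a₅ * P₅ i j + a₆ * P₆ i j

rowMin : Matrix3 → Fin 3 → ℕ
rowMin M i = M i f0 ⊓ M i f1 ⊓ M i f2

rowMax : Matrix3 → Fin 3 → ℕ
rowMax M i = M i f0 ⊔ M i f1 ⊔ M i f2

minEntry : Matrix3 → ℕ
minEntry M = rowMin M f0 ⊓ rowMin M f1 ⊓ rowMin M f2

maxEntry : Matrix3 → ℕ
maxEntry M = rowMax M f0 ⊔ rowMax M f1 ⊔ rowMax M f2

-- P₁, P₂, P₃ are the cyclic permutation matrices and P₄, P₅, P₆ the anti-cyclic ones.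
-- Every cell lies on exactly one matrix of each kind, and each cyclic matrix meets
-- each anti-cyclic one in exactly one cell. So the nine entries of M are precisely
-- the nine sums aₖ + aₗ with k ∈ {1,2,3}, l ∈ {4,5,6}, and the smallest (largest)
-- such sum is the smallest (largest) aₖ plus the smallest (largest) aₗ.
module Submission where

open import Defs
open import Data.Nat using (ℕ; _+_; _*_; _⊓_; _⊔_; _≤_)
open import Data.Nat.Properties
  using (≤-trans; ≤-reflexive; ≤-antisym; +-mono-≤; m⊓n≤m; m⊓n≤n; ⊓-glb; ⊓-sel;
         m≤m⊔n; m≤n⊔m; ⊔-lub; ⊔-sel)
open import Data.Nat.Tactic.RingSolver using (solve)
open import Data.Fin using (Fin; zero; suc)
open import Data.Vec using ([]; _∷_; lookup; toList)
open import Data.Product using (∃; ∃₂; _×_; _,_; proj₁; proj₂)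
open import Data.List using (List)
open import Data.Sum using (inj₁; inj₂)
open import Relation.Binary.PropositionalEquality using (_≡_; sym; trans; cong₂)

min₃ max₃ : (Fin 3 → ℕ) → ℕ
min₃ v = v f0 ⊓ v f1 ⊓ v f2
max₃ v = v f0 ⊔ v f1 ⊔ v f2

min₃≤ : ∀ v k → min₃ v ≤ v k
min₃≤ v zero             = ≤-trans (m⊓n≤m _ _) (m⊓n≤m _ _)
min₃≤ v (suc zero)       = ≤-trans (m⊓n≤m _ _) (m⊓n≤n _ _)
min₃≤ v (suc (suc zero)) = m⊓n≤n _ _

min₃-glb : ∀ {m} v → (∀ k → m ≤ v k) → m ≤ min₃ v
min₃-glb v m≤v = ⊓-glb (⊓-glb (m≤v f0) (m≤v f1)) (m≤v f2)

min₃-sel : ∀ v → ∃ λ k → min₃ v ≡ v k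
min₃-sel v with ⊓-sel (v f0 ⊓ v f1) (v f2) | ⊓-sel (v f0) (v f1)
... | inj₂ eq₂ | _        = f2 , eq₂
... | inj₁ eq  | inj₁ eq₀ = f0 , trans eq eq₀
... | inj₁ eq  | inj₂ eq₁ = f1 , trans eq eq₁

≤max₃ : ∀ v k → v k ≤ max₃ v
≤max₃ v zero             = ≤-trans (m≤m⊔n _ _) (m≤m⊔n _ _)
≤max₃ v (suc zero)       = ≤-trans (m≤n⊔m (v f0) _) (m≤m⊔n _ (v f2))
≤max₃ v (suc (suc zero)) = m≤n⊔m _ _

max₃-lub : ∀ {m} v → (∀ k → v k ≤ m) → max₃ v ≤ m
max₃-lub v v≤m = ⊔-lub (⊔-lub (v≤m f0) (v≤m f1)) (v≤m f2)

max₃-sel : ∀ v → ∃ λ k → max₃ v ≡ v k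
max₃-sel v with ⊔-sel (v f0 ⊔ v f1) (v f2) | ⊔-sel (v f0) (v f1)
... | inj₂ eq₂ | _        = f2 , eq₂
... | inj₁ eq  | inj₁ eq₀ = f0 , trans eq eq₀
... | inj₁ eq  | inj₂ eq₁ = f1 , trans eq eq₁

minEntry≤ : ∀ M i j → minEntry M ≤ M i j
minEntry≤ M i j = ≤-trans (min₃≤ (rowMin M) i) (min₃≤ (M i) j)

minEntry-glb : ∀ {m} M → (∀ i j → m ≤ M i j) → m ≤ minEntry M
minEntry-glb M m≤M = min₃-glb (rowMin M) λ i → min₃-glb (M i) (m≤M i)

≤maxEntry : ∀ M i j → M i j ≤ maxEntry M
≤maxEntry M i j = ≤-trans (≤max₃ (M i) j) (≤max₃ (rowMax M) i)

maxEntry-lub : ∀ {m} M → (∀ i j → M i j ≤ m) → maxEntry M ≤ m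
maxEntry-lub M M≤m = max₃-lub (rowMax M) λ i → max₃-lub (M i) (M≤m i)

record IsAdditionTable (M : Matrix3) (x y : Fin 3 → ℕ) : Set where
  field
    split : ∀ i j → ∃₂ λ k l → M i j ≡ x k + y l
    place : ∀ k l → ∃₂ λ i j → M i j ≡ x k + y l

module _ {M : Matrix3} {x y : Fin 3 → ℕ} (table : IsAdditionTable M x y) where
  open IsAdditionTable table

  minEntry-additionTable : minEntry M ≡ min₃ x + min₃ y
  minEntry-additionTable = ≤-antisym attained bounded
    where
    attained : minEntry M ≤ min₃ x + min₃ y
    attained with min₃-sel x | min₃-sel y
    ... | k , x-min | l , y-min with place k l
    ... | i , j , eq = ≤-trans (minEntry≤ M i j) (≤-reflexive (trans eq (sym (cong₂ _+_ x-min y-min))))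

    bounded : min₃ x + min₃ y ≤ minEntry M
    bounded = minEntry-glb M λ i j →
      let (k , l , eq) = split i j in ≤-trans (+-mono-≤ (min₃≤ x k) (min₃≤ y l)) (≤-reflexive (sym eq))

  maxEntry-additionTable : maxEntry M ≡ max₃ x + max₃ y
  maxEntry-additionTable = ≤-antisym bounded attained
    where
    attained : max₃ x + max₃ y ≤ maxEntry M
    attained with max₃-sel x | max₃-sel y
    ... | k , x-max | l , y-max with place k l
    ... | i , j , eq = ≤-trans (≤-reflexive (trans (cong₂ _+_ x-max y-max) (sym eq))) (≤maxEntry M i j)

    bounded : maxEntry M ≤ max₃ x + max₃ y
    bounded = maxEntry-lub M λ i j →
      let (k , l , eq) = split i j in ≤-trans (≤-reflexive eq) (+-mono-≤ (≤max₃ x k) (≤max₃ y l))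

represents⇒isAdditionTable : ∀ {M} a₁ a₂ a₃ a₄ a₅ a₆ → Represents a₁ a₂ a₃ a₄ a₅ a₆ M →
  IsAdditionTable M (lookup (a₁ ∷ a₂ ∷ a₃ ∷ [])) (lookup (a₄ ∷ a₅ ∷ a₆ ∷ []))
represents⇒isAdditionTable {M} a₁ a₂ a₃ a₄ a₅ a₆ rep = record { split = split ; place = place }
  where
  -- The summands u, v are passed explicitly so that the solver sees variables, not lookups.
  entry : ∀ {i j} u v → a₁ * P₁ i j + a₂ * P₂ i j + a₃ * P₃ i j
                        + a₄ * P₄ i j + a₅ * P₅ i j + a₆ * P₆ i j ≡ u + v → M i j ≡ u + v
  entry {i} {j} _ _ = trans (rep i j)

  x y : Fin 3 → ℕ
  x = lookup (a₁ ∷ a₂ ∷ a₃ ∷ [])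
  y = lookup (a₄ ∷ a₅ ∷ a₆ ∷ [])

  vars : List ℕ
  vars = toList (a₁ ∷ a₂ ∷ a₃ ∷ a₄ ∷ a₅ ∷ a₆ ∷ [])

  split : ∀ i j → ∃₂ λ k l → M i j ≡ x k + y l
  split zero             zero             = f0 , f2 , entry a₁ a₆ (solve vars)
  split zero             (suc zero)       = f2 , f1 , entry a₃ a₅ (solve vars)
  split zero             (suc (suc zero)) = f1 , f0 , entry a₂ a₄ (solve vars)
  split (suc zero)       zero             = f1 , f1 , entry a₂ a₅ (solve vars)
  split (suc zero)       (suc zero)       = f0 , f0 , entry a₁ a₄ (solve vars)
  split (suc zero)       (suc (suc zero)) = f2 , f2 , entry a₃ a₆ (solve vars)
  split (suc (suc zero)) zero             = f2 , f0 , entry a₃ a₄ (solve vars)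
  split (suc (suc zero)) (suc zero)       = f1 , f2 , entry a₂ a₆ (solve vars)
  split (suc (suc zero)) (suc (suc zero)) = f0 , f1 , entry a₁ a₅ (solve vars)

  at : ∀ i j → M i j ≡ x (proj₁ (split i j)) + y (proj₁ (proj₂ (split i j)))
  at i j = proj₂ (proj₂ (split i j))

  place : ∀ k l → ∃₂ λ i j → M i j ≡ x k + y l
  place zero             zero             = f1 , f1 , at f1 f1
  place zero             (suc zero)       = f2 , f2 , at f2 f2
  place zero             (suc (suc zero)) = f0 , f0 , at f0 f0
  place (suc zero)       zero             = f0 , f2 , at f0 f2
  place (suc zero)       (suc zero)       = f1 , f0 , at f1 f0
  place (suc zero)       (suc (suc zero)) = f2 , f1 , at f2 f1
  place (suc (suc zero)) zero             = f2 , f0 , at f2 f0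
  place (suc (suc zero)) (suc zero)       = f0 , f1 , at f0 f1
  place (suc (suc zero)) (suc (suc zero)) = f1 , f2 , at f1 f2

proposition3p4 : (M : Matrix3) → SemiMagic M →
    (a₁ a₂ a₃ a₄ a₅ a₆ : ℕ) → Represents a₁ a₂ a₃ a₄ a₅ a₆ M →
      (minEntry M ≡ (a₁ ⊓ a₂ ⊓ a₃) + (a₄ ⊓ a₅ ⊓ a₆))
      × (maxEntry M ≡ (a₁ ⊔ a₂ ⊔ a₃) + (a₄ ⊔ a₅ ⊔ a₆))
proposition3p4 M _ a₁ a₂ a₃ a₄ a₅ a₆ rep = minEntry-additionTable table , maxEntry-additionTable table
  where
  table : IsAdditionTable M (lookup (a₁ ∷ a₂ ∷ a₃ ∷ [])) (lookup (a₄ ∷ a₅ ∷ a₆ ∷ []))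
  table = represents⇒isAdditionTable a₁ a₂ a₃ a₄ a₅ a₆ rep
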